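{- Assume the closure operator $\mathrm{cl}$ is finitary. Then the map $D\mapsto F_D$ is an order embedding of $(\overline{\mathbf D},\subseteq)$ into the partially ordered set $(\overline{\mathbf F}_{\mathrm{fin}},\subseteq)$ of all finitely coherent SDFSes; its image is exactly the set of all conjunctive finitely coherent SDFSes, and on this image its inverse is the map $F\mapsto D_F$.
   Context: Let $\mathcal T$ be a non-empty set (of "things"). Let $\mathrm{cl}:\mathcal P(\mathcal T)\to\mathcal P(\mathcal T)$ be a closure operator (extensive, monotone, idempotent); it is finitary if $\mathrm{cl}(A)=\bigcup\{\mathrm{cl}(F):F\subseteq A,\ F\text{ finite}\}$ for all $A\subseteq\mathcal T$. Let $\mathcal T_-\subseteq\mathcal T$ be a set of forbidden things and $\mathcal T_+:=\mathrm{cl}(\emptyset)$; standing assumption: $\mathcal T_+\cap\mathcal T_-=\emptyset$. A coherent SDT is a $D\subseteq\mathcal T$ with $\mathrm{cl}(D)=D$ and $D\cap\mathcal T_-=\emptyset$; $\overline{\mathbf D}$ is the set of all coherent SDTs. $\mathcal Q(\mathcal T)$ denotes the set of all finite subsets of $\mathcal T$ (including $\emptyset$). For $\mathcal V\subseteq\mathcal P(\mathcal T)$, $\Sigma_{\mathcal V}$ is the set of maps $\sigma:\mathcal V\to\mathcal T$ with $\sigma(A)\in A$ for all $A\in\mathcal V$, and $\sigma(\mathcal V):=\{\sigma(A):A\in\mathcal V\}$. An SDFS is any $F\subseteq\mathcal Q(\mathcal T)$. It is finitely coherent if (F1) $\emptyset\notin F$; (F2) if $A_1\in F$ and $A_1\subseteq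 A_2\in\mathcal Q(\mathcal T)$ then $A_2\in F$; (F3) if $A\in F$ then $A\setminus\mathcal T_-\in F$; (F4) $\{t\}\in F$ for all $t\in\mathcal T_+$; (F5) for every non-empty finite $\mathcal V\subseteq F$ and every family $(t_\sigma)_{\sigma\in\Sigma_{\mathcal V}}$ with $t_\sigma\in\mathrm{cl}(\sigma(\mathcal V))$, $\{t_\sigma:\sigma\in\Sigma_{\mathcal V}\}\in F$. An SDFS $F$ is conjunctive if for all $A\in F$ there is $t\in A$ with $\{t\}\in F$. For $D\subseteq\mathcal T$ let $F_D:=\{A\in\mathcal Q(\mathcal T):A\cap D\neq\emptyset\}$, and for an SDFS $F$ let $D_F:=\{t\in\mathcal T:\{t\}\in F\}$. An order embedding is a map $f$ with $x\le y\iff f(x)\le f(y)$. -}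

module Defs where

open import Level using (0ℓ)
open import Data.Product using (Σ; ∃; _×_; _,_)
open import Data.Empty using (⊥)
open import Data.List using (List; []; _∷_; [_]; map; concatMap)
open import Data.List.Membership.Propositional using (_∈_; mapWith∈)
open import Relation.Nullary using (¬_)
open import Relation.Unary using (Pred; _⊆_; _≐_; ∅)

module Setup (T : Set) (cl : Pred T 0ℓ → Pred T 0ℓ) (T₋ : Pred T 0ℓ) where

  record IsClosure : Set₁ where
    field
      extensive  : ∀ (A : Pred T 0ℓ) → A ⊆ cl A
      monotone   : ∀ (A B : Pred T 0ℓ) → A ⊆ B → cl A ⊆ cl B
      idempotent : ∀ (A : Pred T 0ℓ) → cl (cl A) ≐ cl A

  ⟦_⟧ : List T → Pred T 0ℓ
  ⟦ L ⟧ = λ x → x ∈ L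

  Finitary : Set₁
  Finitary = ∀ (A : Pred T 0ℓ) →
    cl A ≐ (λ t → ∃ λ (L : List T) → (⟦ L ⟧ ⊆ A) × cl ⟦ L ⟧ t)

  T₊ : Pred T 0ℓ
  T₊ = cl ∅

  Coherent : Pred T 0ℓ → Set
  Coherent D = (cl D ≐ D) × (∀ {t} → D t → ¬ T₋ t)

  -- an SDFS: a set of finite subsets of T (finite subsets represented by lists)
  SDFS : Set₁
  SDFS = Pred (List T) 0ℓ

  -- all choice lists σ(𝒱) for a list of finite sets 𝒱 = [A₁,…,Aₙ]
  -- (one element from each Aᵢ), i.e. the choice maps σ ∈ Σ_𝒱
  choices : List (List T) → List (List T)
  choices []       = [ [] ]
  choices (A ∷ 𝒱) = concatMap (λ a → map (a ∷_) (choices 𝒱)) A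

  record FinitelyCoherent (F : SDFS) : Set₁ where
    field
      F1 : ¬ F []
      F2 : ∀ (A₁ A₂ : List T) → F A₁ → ⟦ A₁ ⟧ ⊆ ⟦ A₂ ⟧ → F A₂
      -- any list B representing A ∖ T₋
      F3 : ∀ (A B : List T) → F A →
             (∀ x → (x ∈ B → x ∈ A × ¬ T₋ x) × (x ∈ A × ¬ T₋ x → x ∈ B)) → F B
      F4 : ∀ (t : T) → T₊ t → F [ t ]
      F5 : ∀ (A : List T) (𝒱 : List (List T)) → (∀ {B} → B ∈ (A ∷ 𝒱) → F B) →
             (t : ∀ σ → σ ∈ choices (A ∷ 𝒱) → T) →
             (∀ σ (p : σ ∈ choices (A ∷ 𝒱)) → cl ⟦ σ ⟧ (t σ p)) →
             F (mapWith∈ (choices (A ∷ 𝒱)) (λ {σ} p → t σ p))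

  Conjunctive : SDFS → Set
  Conjunctive F = ∀ A → F A → ∃ λ t → t ∈ A × F [ t ]

  F[_] : Pred T 0ℓ → SDFS
  F[ D ] = λ A → ∃ λ t → t ∈ A × D t

  D[_] : SDFS → Pred T 0ℓ
  D[ F ] = λ t → F [ t ]

  Theorem2Claim : Set₁
  Theorem2Claim =
    (∀ D → Coherent D → FinitelyCoherent F[ D ] × Conjunctive F[ D ])
    × (∀ D₁ D₂ → Coherent D₁ → Coherent D₂ →
         (D₁ ⊆ D₂ → F[ D₁ ] ⊆ F[ D₂ ]) × (F[ D₁ ] ⊆ F[ D₂ ] → D₁ ⊆ D₂))
    × (∀ F → FinitelyCoherent F → Conjunctive F →
         Σ (Pred T 0ℓ) λ D → Coherent D × (F[ D ] ≐ F))
    × (∀ D → Coherent D → D[ F[ D ] ] ≐ D)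
    × (∀ F → FinitelyCoherent F → Conjunctive F →
         Coherent D[ F ] × (F[ D[ F ] ] ≐ F))

{-# OPTIONS --safe #-}
module Submission where

-- A coherent D is recovered from F_D through its singletons, so D ↦ F_D is an
-- order embedding with left inverse F ↦ D_F. For a conjunctive F, upward
-- closure (F2) gives F = F_{D_F}. That D_F is closed uses finitarity: if t lies
-- in cl {a₁,…,aₙ} with every {aᵢ} ∈ F, then (F5) applied to the singletons
-- {a₁},…,{aₙ} has the single choice (a₁,…,aₙ), so choosing t for it yields {t} ∈ F.

open import Defs
open import Level using (0ℓ)
open import Relation.Nullary using (¬_; contradiction)
open import Relation.Unary using (Pred; ∅; _⊆_; _≐_)
open import Data.Product using (∃; _×_; _,_; proj₁; proj₂)
open import Data.List using (List; []; _∷_; [_]; map)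
open import Data.List.Membership.Propositional using (_∈_; lose; mapWith∈)
open import Data.List.Membership.Propositional.Properties
  using (∈-map⁻; ∈-map⁺; ∈-concatMap⁺; ∈-concatMap⁻)
open import Data.List.Relation.Unary.Any using (here; there)
open import Data.List.Relation.Unary.Any.Properties using (mapWith∈⁺; mapWith∈⁻)
open import Relation.Binary.PropositionalEquality using (_≡_; refl; sym; cong; subst)

module Correspondence (T : Set) (cl : Pred T 0ℓ → Pred T 0ℓ) (T₋ : Pred T 0ℓ) where
  open Setup T cl T₋

  choice-within : ∀ {P : Pred T 0ℓ} (𝒱 : List (List T)) → (∀ {B} → B ∈ 𝒱 → F[ P ] B) →
                  ∃ λ σ → σ ∈ choices 𝒱 × ⟦ σ ⟧ ⊆ P
  choice-within [] _ = [] , here refl , λ ()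
  choice-within (A ∷ 𝒱) meets
    with meets (here refl) | choice-within 𝒱 (λ B∈𝒱 → meets (there B∈𝒱))
  ... | u , u∈A , Pu | σ , σ∈choices , σ⊆P =
    u ∷ σ , ∈-concatMap⁺ _ (lose u∈A (∈-map⁺ (u ∷_) σ∈choices)) ,
    λ { (here refl) → Pu ; (there x∈σ) → σ⊆P x∈σ }

  ∈-choices-singletons⁻ : ∀ (L : List T) {σ} → σ ∈ choices (map [_] L) → σ ≡ L
  ∈-choices-singletons⁻ []      (here σ≡[]) = σ≡[]
  ∈-choices-singletons⁻ (a ∷ L) σ∈choices
    with ∈-concatMap⁻ (λ x → map (x ∷_) (choices (map [_] L))) {xs = [ a ]} σ∈choices
  ... | here σ∈a∷choices with ∈-map⁻ (a ∷_) σ∈a∷choices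
  ...   | σ′ , σ′∈choices , refl = cong (a ∷_) (∈-choices-singletons⁻ L σ′∈choices)

  F-monotone : ∀ {D₁ D₂} → D₁ ⊆ D₂ → F[ D₁ ] ⊆ F[ D₂ ]
  F-monotone D₁⊆D₂ (t , t∈A , D₁t) = t , t∈A , D₁⊆D₂ D₁t

  D-F-inverse : ∀ D → D[ F[ D ] ] ≐ D
  D-F-inverse D = (λ { (_ , here refl , Dt) → Dt }) , λ Dt → _ , here refl , Dt

  F-reflects-⊆ : ∀ {D₁ D₂} → F[ D₁ ] ⊆ F[ D₂ ] → D₁ ⊆ D₂
  F-reflects-⊆ {D₁} {D₂} F₁⊆F₂ D₁t =
    proj₁ (D-F-inverse D₂) (F₁⊆F₂ (proj₂ (D-F-inverse D₁) D₁t))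

  F-conjunctive : ∀ D → Conjunctive F[ D ]
  F-conjunctive D A (t , t∈A , Dt) = t , t∈A , proj₂ (D-F-inverse D) Dt

  F-D-inverse : ∀ {F} → FinitelyCoherent F → Conjunctive F → F[ D[ F ] ] ≐ F
  F-D-inverse fc conj =
    (λ { (t , t∈A , F[t]) → F2 [ t ] _ F[t] λ { (here refl) → t∈A } }) , conj _
    where open FinitelyCoherent fc

  module _ (isClosure : IsClosure) where
    open IsClosure isClosure

    F-finitelyCoherent : ∀ {D} → Coherent D → FinitelyCoherent F[ D ]
    F-finitelyCoherent {D} ((cl-D⊆D , _) , D∩T₋=∅) = record
      { F1 = λ { (_ , () , _) }
      ; F2 = λ { _ _ (t , t∈A₁ , Dt) A₁⊆A₂ → t , A₁⊆A₂ t∈A₁ , Dt }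
      ; F3 = λ { _ _ (t , t∈A , Dt) B≐A∖T₋ → t , proj₂ (B≐A∖T₋ t) (t∈A , D∩T₋=∅ Dt) , Dt }
      ; F4 = λ t T₊t → t , here refl , cl-D⊆D (monotone ∅ D (λ ()) T₊t)
      ; F5 = F5
      }
      where
      F5 : ∀ A 𝒱 → (∀ {B} → B ∈ (A ∷ 𝒱) → F[ D ] B) →
           (t : ∀ σ → σ ∈ choices (A ∷ 𝒱) → T) →
           (∀ σ (p : σ ∈ choices (A ∷ 𝒱)) → cl ⟦ σ ⟧ (t σ p)) →
           F[ D ] (mapWith∈ (choices (A ∷ 𝒱)) (λ {σ} p → t σ p))
      F5 A 𝒱 meets t t∈cl with choice-within (A ∷ 𝒱) meets
      ... | σ , σ∈choices , σ⊆D =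
        t σ σ∈choices , mapWith∈⁺ _ (σ , σ∈choices , refl) ,
        cl-D⊆D (monotone ⟦ σ ⟧ D σ⊆D (t∈cl σ σ∈choices))

    D-coherent : Finitary → ∀ {F} → FinitelyCoherent F → Coherent D[ F ]
    D-coherent finitary {F} fc = (cl-D⊆D , extensive D[ F ]) , D∩T₋=∅
      where
      open FinitelyCoherent fc

      D∩T₋=∅ : ∀ {t} → F [ t ] → ¬ T₋ t
      D∩T₋=∅ {t} F[t] T₋t =
        F1 (F3 [ t ] [] F[t] λ _ → (λ ()) , λ { (here refl , ¬T₋t) → contradiction T₋t ¬T₋t })

      cl-list⊆D : ∀ a L {t} → ⟦ a ∷ L ⟧ ⊆ D[ F ] → cl ⟦ a ∷ L ⟧ t → F [ t ]
      cl-list⊆D a L {t} L⊆D t∈cl =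
        F2 _ [ t ] (F5 [ a ] (map [_] L) singletons∈F (λ _ _ → t) t∈cl⟦σ⟧)
          λ t′∈ → here (proj₂ (proj₂ (mapWith∈⁻ _ _ t′∈)))
        where
        singletons∈F : ∀ {B} → B ∈ map [_] (a ∷ L) → F B
        singletons∈F B∈ with ∈-map⁻ [_] B∈
        ... | _ , x∈L , refl = L⊆D x∈L

        t∈cl⟦σ⟧ : ∀ σ → σ ∈ choices (map [_] (a ∷ L)) → cl ⟦ σ ⟧ t
        t∈cl⟦σ⟧ σ σ∈choices =
          subst (λ τ → cl ⟦ τ ⟧ t) (sym (∈-choices-singletons⁻ (a ∷ L) σ∈choices)) t∈cl

      cl-D⊆D : cl D[ F ] ⊆ D[ F ]
      cl-D⊆D t∈cl with proj₁ (finitary D[ F ]) t∈cl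
      ... | []    , _   , t∈cl∅ = F4 _ (monotone ⟦ [] ⟧ ∅ (λ ()) t∈cl∅)
      ... | a ∷ L , L⊆D , t∈clL = cl-list⊆D a L L⊆D t∈clL

theorem2 : (T : Set) → T → (cl : Pred T 0ℓ → Pred T 0ℓ) (T₋ : Pred T 0ℓ) →
    Setup.IsClosure T cl T₋ → Setup.Finitary T cl T₋ →
    (∀ t → cl ∅ t → ¬ T₋ t) →
    Setup.Theorem2Claim T cl T₋
theorem2 T _ cl T₋ isClosure finitary _ =
    (λ D coherent → F-finitelyCoherent isClosure coherent , F-conjunctive D)
  , (λ _ _ _ _ → F-monotone , F-reflects-⊆)
  , (λ F fc conj → D[ F ] , D-coherent isClosure finitary fc , F-D-inverse fc conj)
  , (λ D _ → D-F-inverse D)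
  , (λ F fc conj → D-coherent isClosure finitary fc , F-D-inverse fc conj)
  where
  open Setup T cl T₋ using (D[_])
  open Correspondence T cl T₋
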